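{- Let $\mathcal{F}$ be the free non-symmetric operad on two binary generators $\alpha,\beta$, and let $\pi:\mathcal{F}\to\mathrm{CNCB}$ be the operad morphism with $\pi(\alpha)=\tau_{bab}$ and $\pi(\beta)=\tau_{aba}$. Then $\pi$ induces an isomorphism from $\mathcal{F}/_{\equiv}$ onto the suboperad $\langle\tau_{bab},\tau_{aba}\rangle$, where $\equiv$ is the smallest operad congruence of $\mathcal{F}$ containing $\beta\circ_1\beta\equiv\beta\circ_2\beta$ and $\alpha\circ_1\alpha\equiv\alpha\circ_2\alpha$.
   Context: A bicoloured noncrossing configuration (BNC) of size $n\ge2$ is a regular polygon with vertices $1,\dots,n+1$ (clockwise) with each arc $(i,j)$, $1\le i<j\le n+1$, coloured blue, red or uncoloured, such that no two coloured (blue or red) arcs cross and red arcs are diagonals. The edges are $(i,i+1)$ for $i\in[n]$ (the $i$-th edge), the base is $(1,n+1)$, and the other arcs are diagonals. There is also a unique BNC of size $1$, a single blue arc (its edge and base). $\mathrm{CNCB}$ is the non-symmetric operad of BNCs (arity = size, unit = the size-$1$ BNC) with composition $\mathfrak{C}\circ_i\mathfrak{D}$ ($\mathfrak{C}$ of size $n$, $\mathfrak{D}$ of size $m$) obtained by gluing the base of $\mathfrak{D}$ onto the $i$-th edge of $\mathfrak{C}$. Vertex $j$ of $\mathfrak{C}$ goes to $j$ if $j\le i$ and to $j+m-1$ otherwise, and vertex $\ell$ of $\mathfrak{D}$ goes to $i+\ell-1$. All other arcs keep their colours. The arc $(i,i+m)$ is red if the $i$-th edge of $\mathfrak{C}$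 and the base of $\mathfrak{D}$ are both uncoloured, blue if both are blue, and uncoloured otherwise. All remaining arcs are uncoloured. For $x,y,z\in\{a,b\}$, $\tau_{xyz}$ is the BNC of size $2$ (a triangle, which has no diagonals) whose first edge $(1,2)$, base $(1,3)$ and second edge $(2,3)$ are respectively coloured $x,y,z$, where $a$ means blue and $b$ means uncoloured. $\langle G\rangle$ denotes the smallest suboperad of $\mathrm{CNCB}$ containing $G$. -}

module Defs where

open import Data.Nat using (ℕ; zero; suc; _+_; _∸_; _≤_; _<_; _≤ᵇ_; _≡ᵇ_)
open import Data.Bool using (Bool; true; false; if_then_else_; _∧_; _∨_)
open import Data.Product using (_×_)
open import Relation.Binary.PropositionalEquality using (_≡_)

-- Convention: vertices are numbered 0,…,n (the paper's 1,…,n+1 shifted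
-- by one).  The arc between vertices x < y has colour  col x y.
-- The k-th edge (k = 1..n) is (k-1 , k), the base is (0 , n).
-- Values of col outside 0 ≤ x < y ≤ n are irrelevant (see _≈_).

data Colour : Set where
  blue red none : Colour

record BNC : Set where
  constructor mk
  field
    size : ℕ
    col  : ℕ → ℕ → Colour
open BNC public

_≈_ : BNC → BNC → Set
C ≈ D = (size C ≡ size D) × (∀ x y → x < y → y ≤ size C → col C x y ≡ col D x y)

unitB : BNC
unitB = mk 1 (λ _ _ → blue)

-- colour of the new arc (i , i+m) obtained from the i-th edge of C and
-- the base of D
merge : Colour → Colour → Colour
merge none none = red
merge blue blue = blue
merge _    _    = none

-- partial composition  C ∘ᵢ D  (i is 1-based, meaningful for 1 ≤ i ≤ size C):
-- glue the base of D onto the i-th edge of C.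
compose : BNC → ℕ → BNC → BNC
compose (mk n c) i (mk m d) = mk (n + m ∸ 1) r
  where
  p : ℕ            -- 0-based position of the left end of the i-th edge
  p = i ∸ 1
  outside : ℕ → Bool
  outside z = (z ≤ᵇ p) ∨ ((p + m) ≤ᵇ z)
  back : ℕ → ℕ     -- inverse of the relabelling of vertices of C
  back z = if z ≤ᵇ p then z else z ∸ (m ∸ 1)
  r : ℕ → ℕ → Colour
  r x y =
    if (p ≤ᵇ x) ∧ (y ≤ᵇ p + m)
      then (if (x ≡ᵇ p) ∧ (y ≡ᵇ p + m)
              then merge (c p (suc p)) (d 0 m)
              else d (x ∸ p) (y ∸ p))
      else (if outside x ∧ outside y
              then c (back x) (back y)
              else none)

-- τ_xyz : triangle (size 2) with first edge (0,1) = x, base (0,2) = y,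
-- second edge (1,2) = z
triangle : Colour → Colour → Colour → BNC
triangle x y z = mk 2 f
  where
  f : ℕ → ℕ → Colour
  f 0 1 = x
  f 0 2 = y
  f 1 2 = z
  f _ _ = none

τbab : BNC
τbab = triangle none blue none

τaba : BNC
τaba = triangle blue none blue

data InGen : BNC → Set where
  g-unit : InGen unitB
  g-bab  : InGen τbab
  g-aba  : InGen τaba
  g-comp : ∀ {C D} (i : ℕ) → 1 ≤ i → i ≤ size C →
           InGen C → InGen D → InGen (compose C i D)

data Gen : Set where
  α β : Gen

data Tree : Set where
  leaf : Tree
  node : Gen → Tree → Tree → Tree

arity : Tree → ℕ
arity leaf = 1
arity (node _ l r) = arity l + arity r

-- partial composition t ∘ᵢ s : graft s on the i-th leaf (1-based) of t
graft : Tree → ℕ → Tree → Tree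
graft leaf i s = s
graft (node g l r) i s =
  if i ≤ᵇ arity l then node g (graft l i s) r
                  else node g l (graft r (i ∸ arity l) s)

data _≅_ : Tree → Tree → Set where
  ax-β  : node β (node β leaf leaf) leaf ≅ node β leaf (node β leaf leaf)
  ax-α  : node α (node α leaf leaf) leaf ≅ node α leaf (node α leaf leaf)
  ≅-refl  : ∀ {t} → t ≅ t
  ≅-sym   : ∀ {s t} → s ≅ t → t ≅ s
  ≅-trans : ∀ {s t u} → s ≅ t → t ≅ u → s ≅ u
  ≅-comp  : ∀ {s s' t t'} (i : ℕ) → 1 ≤ i → i ≤ arity s →
            s ≅ s' → t ≅ t' → graft s i t ≅ graft s' i t'

-- the operad morphism π with π(α) = τbab, π(β) = τaba
-- (node g l r = (g ∘₂ r) ∘₁ l)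

πgen : Gen → BNC
πgen α = τbab
πgen β = τaba

π : Tree → BNC
π leaf = unitB
π (node g l r) = compose (compose (πgen g) 2 (π r)) 1 (π l)

{-# OPTIONS --safe #-}
-- Each relation says that one generator is associative, so every ≅-class contains a tree in
-- which no node has a left child with the same label (every maximal cluster of equal labels is
-- a right comb); nf computes it.
--
-- Grafting below a node reduces to
-- associativity of CNCB composition, which holds for well-formed configurations: merge is
-- associative only away from red, so a configuration of size 1 must be the blue unit and no base
-- may be red.  As π identifies the two sides of each relation, it factors through ≅, and its
-- image is exactly the suboperad generated by τbab and τaba.
--
-- π is injective on normal trees.  The base of π (node g l r) has colour baseColour g, which
-- determines g.  If the left subtrees of two normal trees with the same image had sizes a < a′,
-- the arc (0, a′) would cross the left subtree in one image, hence be uncoloured, and be the base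
-- of the left subtree in the other, coloured merge (edgeColour g) (baseColour h) with h ≠ g,
-- which is never uncoloured.  So the left subtrees have equal sizes, and both subtrees are
-- recovered by restriction.
module Submission where

open import Data.Bool using (true; false; if_then_else_; _∧_; _∨_)
open import Data.Empty using (⊥; ⊥-elim)
open import Data.Maybe using (Maybe; just; nothing)
open import Data.Maybe.Properties using (just-injective)
open import Data.Nat
open import Data.Nat.Properties
open import Algebra.Properties.CommutativeSemigroup +-commutativeSemigroup using (xy∙z≈xz∙y)
open import Data.Product using (_×_; _,_; ∃; proj₁)
open import Data.Sum using (_⊎_; inj₁; inj₂)
open import Relation.Binary using (tri<; tri≈; tri>)
open import Relation.Binary.Definitions using (DecidableEquality)
open import Relation.Binary.PropositionalEquality
open import Relation.Nullary using (yes; no)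
open import Relation.Nullary.Decidable using (dec-true; dec-false)

open import Defs

≤ᵇ-true : ∀ {m n} → m ≤ n → (m ≤ᵇ n) ≡ true
≤ᵇ-true {m} {n} = dec-true (m ≤? n)

≤ᵇ-false : ∀ {m n} → n < m → (m ≤ᵇ n) ≡ false
≤ᵇ-false {m} {n} n<m = dec-false (m ≤? n) (<⇒≱ n<m)

≡ᵇ-refl : ∀ m → (m ≡ᵇ m) ≡ true
≡ᵇ-refl m = dec-true (m ≟ m) refl

≡ᵇ-false : ∀ {m n} → m ≢ n → (m ≡ᵇ n) ≡ false
≡ᵇ-false {m} {n} = dec-false (m ≟ n)

-- Composition of colourings

Colouring : Set
Colouring = ℕ → ℕ → Colour

-- col (compose C i D) is definitionally composeCol (col C) (i ∸ 1) (size D) (col D).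
composeCol : Colouring → ℕ → ℕ → Colouring → Colouring
composeCol c p m d x y =
  if (p ≤ᵇ x) ∧ (y ≤ᵇ p + m)
    then (if (x ≡ᵇ p) ∧ (y ≡ᵇ p + m)
            then merge (c p (suc p)) (d 0 m)
            else d (x ∸ p) (y ∸ p))
    else (if ((x ≤ᵇ p) ∨ ((p + m) ≤ᵇ x)) ∧ ((y ≤ᵇ p) ∨ ((p + m) ≤ᵇ y))
            then c (if x ≤ᵇ p then x else x ∸ (m ∸ 1)) (if y ≤ᵇ p then y else y ∸ (m ∸ 1))
            else none)

shifted-≤ : ∀ {p m₀ v} → suc p ≤ v → p + suc m₀ ≤ v + m₀
shifted-≤ {p} {m₀} h rewrite +-suc p m₀ = +-monoˡ-≤ m₀ h

Arc≢ : ℕ → ℕ → ℕ → ℕ → Set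
Arc≢ x y u v = x ≡ u → y ≡ v → ⊥

base-or-other : ∀ x y n → (x ≡ 0 × y ≡ n) ⊎ Arc≢ x y 0 n
base-or-other x y n with x ≟ 0 | y ≟ n
... | yes x≡0 | yes y≡n = inj₁ (x≡0 , y≡n)
... | yes _ | no y≢n = inj₂ (λ _ y≡n → y≢n y≡n)
... | no x≢0 | _ = inj₂ (λ x≡0 _ → x≢0 x≡0)

module _ {c d : Colouring} where

  composeCol-left : ∀ {p m x y} → x < y → y ≤ p → composeCol c p m d x y ≡ c x y
  composeCol-left {p} {m} {x} {y} x<y y≤p
    rewrite ≤ᵇ-false {p} {x} (<-≤-trans x<y y≤p)
          | ≤ᵇ-true {x} {p} (≤-trans (<⇒≤ x<y) y≤p)
          | ≤ᵇ-true {y} {p} y≤p = refl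

  composeCol-glued : ∀ {p m} → composeCol c p m d p (p + m) ≡ merge (c p (suc p)) (d 0 m)
  composeCol-glued {p} {m}
    rewrite ≤ᵇ-true {p} {p} ≤-refl | ≤ᵇ-true {p + m} {p + m} ≤-refl
          | ≡ᵇ-refl p | ≡ᵇ-refl (p + m) = refl

  composeCol-inner : ∀ {p m u v} → u < v → v ≤ m → Arc≢ u v 0 m →
                     composeCol c p m d (p + u) (p + v) ≡ d u v
  composeCol-inner {p} {m} {u} {v} u<v v≤m u,v≢0,m
    rewrite ≤ᵇ-true {p} {p + u} (m≤m+n p u) | ≤ᵇ-true {p + v} {p + m} (+-monoʳ-≤ p v≤m)
    with u ≟ 0
  ... | no u≢0
    rewrite ≡ᵇ-false {p + u} {p} (λ e → u≢0 (+-cancelˡ-≡ p u 0 (trans e (sym (+-identityʳ p)))))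
          | m+n∸m≡n p u | m+n∸m≡n p v = refl
  ... | yes refl
    rewrite +-identityʳ p | ≡ᵇ-refl p
          | ≡ᵇ-false {p + v} {p + m} (λ e → u,v≢0,m refl (+-cancelˡ-≡ p v m e))
          | m+n∸m≡n p v | n∸n≡0 p = refl

  composeCol-over : ∀ {p m₀ x v} → x ≤ p → p < v → Arc≢ x v p (suc p) →
                    composeCol c p (suc m₀) d x (v + m₀) ≡ c x v
  composeCol-over {p} {m₀} {x} {v} x≤p p<v x,v≢edge
    rewrite ≤ᵇ-true {x} {p} x≤p | ≤ᵇ-false {v + m₀} {p} (≤-trans p<v (m≤m+n v m₀))
          | ≤ᵇ-true {p + suc m₀} {v + m₀} (shifted-≤ p<v) | m+n∸n≡m v m₀
    with m≤n⇒m<n∨m≡n x≤p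
  ... | inj₁ x<p rewrite ≤ᵇ-false {p} {x} x<p = refl
  ... | inj₂ refl with m≤n⇒m<n∨m≡n p<v
  ...   | inj₂ refl = ⊥-elim (x,v≢edge refl refl)
  ...   | inj₁ x+1<v rewrite ≤ᵇ-true {x} {x} ≤-refl
          | ≤ᵇ-false {v + m₀} {x + suc m₀} (shifted-≤ {suc x} {m₀} {v} x+1<v) = refl

  composeCol-right : ∀ {p m₀ u v} → p < u → u < v →
                     composeCol c p (suc m₀) d (u + m₀) (v + m₀) ≡ c u v
  composeCol-right {p} {m₀} {u} {v} p<u u<v
    rewrite ≤ᵇ-true {p} {u + m₀} (≤-trans (<⇒≤ p<u) (m≤m+n u m₀))
          | ≤ᵇ-false {v + m₀} {p + suc m₀} (shifted-≤ {suc p} {m₀} {v} (≤-trans (s≤s p<u) u<v))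
          | ≤ᵇ-false {u + m₀} {p} (≤-trans p<u (m≤m+n u m₀))
          | ≤ᵇ-false {v + m₀} {p} (≤-trans (<-trans p<u u<v) (m≤m+n v m₀))
          | ≤ᵇ-true {p + suc m₀} {u + m₀} (shifted-≤ p<u)
          | ≤ᵇ-true {p + suc m₀} {v + m₀} (shifted-≤ (<-trans p<u u<v))
          | m+n∸n≡m v m₀ | m+n∸n≡m u m₀ = refl

  composeCol-crossˡ : ∀ {p m x y} → x < p → p < y → y < p + m → composeCol c p m d x y ≡ none
  composeCol-crossˡ {p} {m} {x} {y} x<p p<y y<p+m
    rewrite ≤ᵇ-false {p} {x} x<p | ≤ᵇ-true {x} {p} (<⇒≤ x<p) | ≤ᵇ-false {y} {p} p<y
          | ≤ᵇ-false {p + m} {y} y<p+m = refl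

  composeCol-crossʳ : ∀ {p m x y} → p < x → x < p + m → p + m < y → composeCol c p m d x y ≡ none
  composeCol-crossʳ {p} {m} {x} {y} p<x x<p+m p+m<y
    rewrite ≤ᵇ-true {p} {x} (<⇒≤ p<x) | ≤ᵇ-false {y} {p + m} p+m<y | ≤ᵇ-false {x} {p} p<x
          | ≤ᵇ-false {p + m} {x} x<p+m = refl

offsetˡ : ∀ {k y} → k ≤ y → ∃ λ v → y ≡ k + v
offsetˡ k≤y with m≤n⇒∃[o]m+o≡n k≤y
... | o , e = o , sym e

offsetʳ : ∀ {k y} → k ≤ y → ∃ λ v → y ≡ v + k
offsetʳ {k} k≤y with m≤n⇒∃[o]m+o≡n k≤y
... | o , e = o , trans (sym e) (+-comm k o)

unshift-≤ : ∀ {p m₀ v} → p + suc m₀ ≤ v + m₀ → suc p ≤ v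
unshift-≤ {p} {m₀} {v} h rewrite +-suc p m₀ = +-cancelʳ-≤ m₀ (suc p) v h

data ComposeArc (p m₀ : ℕ) : ℕ → ℕ → Set where
  left   : ∀ {x y} → x < y → y ≤ p → ComposeArc p m₀ x y
  glued  : ComposeArc p m₀ p (p + suc m₀)
  inner  : ∀ {u v} → u < v → v ≤ suc m₀ → Arc≢ u v 0 (suc m₀) → ComposeArc p m₀ (p + u) (p + v)
  over   : ∀ {x v} → x ≤ p → p < v → Arc≢ x v p (suc p) → ComposeArc p m₀ x (v + m₀)
  right  : ∀ {u v} → p < u → u < v → ComposeArc p m₀ (u + m₀) (v + m₀)
  crossˡ : ∀ {x y} → x < p → p < y → y < p + suc m₀ → ComposeArc p m₀ x y
  crossʳ : ∀ {x y} → p < x → x < p + suc m₀ → p + suc m₀ < y → ComposeArc p m₀ x y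

composeArc : ∀ p m₀ x y → x < y → ComposeArc p m₀ x y
composeArc p m₀ x y x<y with y ≤? p
... | yes y≤p = left x<y y≤p
... | no y≰p with <-cmp x p
...   | tri< x<p _ _ with y <? p + suc m₀
...     | yes y<p+m = crossˡ x<p (≰⇒> y≰p) y<p+m
...     | no y≮p+m with offsetʳ {m₀} {y} (≤-trans (m≤n+m m₀ (suc p)) (subst (_≤ y) (+-suc p m₀) (≮⇒≥ y≮p+m)))
...       | v , refl = over (<⇒≤ x<p) (unshift-≤ {p} {m₀} {v} (≮⇒≥ y≮p+m)) (λ e _ → <⇒≢ x<p e)
composeArc p m₀ x y x<y | no y≰p | tri≈ _ refl _ with y ≟ p + suc m₀
...     | yes refl = glued
...     | no y≢p+m with y <? p + suc m₀
...       | yes y<p+m with offsetˡ {p} {y} (<⇒≤ (≰⇒> y≰p))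
...         | v , refl = subst (λ z → ComposeArc x m₀ z (x + v)) (+-identityʳ x)
                 (inner {u = 0} (+-cancelˡ-< x 0 v (subst (_< x + v) (sym (+-identityʳ x)) x<y))
                    (+-cancelˡ-≤ x v (suc m₀) (<⇒≤ y<p+m)) (λ _ e → y≢p+m (cong (x +_) e)))
composeArc p m₀ x y x<y | no y≰p | tri≈ _ refl _ | no y≢p+m | no y≮p+m
  with offsetʳ {m₀} {y} (≤-trans (m≤n+m m₀ (suc x)) (subst (_≤ y) (+-suc x m₀) (≮⇒≥ y≮p+m)))
... | v , refl = over ≤-refl (unshift-≤ {x} {m₀} {v} (≮⇒≥ y≮p+m))
        (λ _ e → y≢p+m (trans (cong (_+ m₀) e) (sym (+-suc x m₀))))
composeArc p m₀ x y x<y | no y≰p | tri> _ _ p<x with x <? p + suc m₀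
...   | yes x<p+m with y ≤? p + suc m₀
...     | yes y≤p+m with offsetˡ {p} {x} (<⇒≤ p<x) | offsetˡ {p} {y} (<⇒≤ (≰⇒> y≰p))
...       | u , refl | v , refl =
            inner (+-cancelˡ-< p u v x<y) (+-cancelˡ-≤ p v (suc m₀) y≤p+m)
              (λ e _ → <⇒≢ p<x (sym (trans (cong (p +_) e) (+-identityʳ p))))
composeArc p m₀ x y x<y | no y≰p | tri> _ _ p<x | yes x<p+m | no y≰p+m = crossʳ p<x x<p+m (≰⇒> y≰p+m)
composeArc p m₀ x y x<y | no y≰p | tri> _ _ p<x | no x≮p+m
  with offsetʳ {m₀} {x} (≤-trans (m≤n+m m₀ (suc p)) (subst (_≤ x) (+-suc p m₀) (≮⇒≥ x≮p+m)))
... | u , refl with offsetʳ {m₀} {y} (≤-trans (m≤n+m m₀ u) (<⇒≤ x<y))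
...   | v , refl = right (unshift-≤ {p} {m₀} {u} (≮⇒≥ x≮p+m)) (+-cancelʳ-< m₀ u v x<y)

Agree : ℕ → Colouring → Colouring → Set
Agree n c c′ = ∀ x y → x < y → y ≤ n → c x y ≡ c′ x y

agree-split : ∀ {n} {c c′ : Colouring} → c 0 n ≡ c′ 0 n →
              (∀ x y → x < y → y ≤ n → Arc≢ x y 0 n → c x y ≡ c′ x y) → Agree n c c′
agree-split {n} base others x y x<y y≤n with base-or-other x y n
... | inj₁ (refl , refl) = base
... | inj₂ ≢base = others x y x<y y≤n ≢base

composeCol-congʳ : ∀ {c d d′ p m₀} → Agree (suc m₀) d d′ →
                   ∀ x y → x < y → composeCol c p (suc m₀) d x y ≡ composeCol c p (suc m₀) d′ x y
composeCol-congʳ {c} {d} {d′} {p} {m₀} d≗d′ x y x<y with composeArc p m₀ x y x<y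
... | left _ y≤p =
  trans (composeCol-left {c = c} {d} x<y y≤p) (sym (composeCol-left {c = c} {d′} x<y y≤p))
... | glued =
  trans (composeCol-glued {c = c} {d} {p})
    (trans (cong (merge (c p (suc p))) (d≗d′ 0 (suc m₀) (s≤s z≤n) ≤-refl))
      (sym (composeCol-glued {c = c} {d′} {p})))
... | inner {u} {v} u<v v≤m ≢base =
  trans (composeCol-inner {c = c} {d} {p} u<v v≤m ≢base)
    (trans (d≗d′ u v u<v v≤m) (sym (composeCol-inner {c = c} {d′} {p} u<v v≤m ≢base)))
... | over x≤p p<v ≢edge =
  trans (composeCol-over {c = c} {d} x≤p p<v ≢edge) (sym (composeCol-over {c = c} {d′} x≤p p<v ≢edge))
... | right p<u u<v =
  trans (composeCol-right {c = c} {d} p<u u<v) (sym (composeCol-right {c = c} {d′} p<u u<v))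
... | crossˡ x<p p<y y<p+m =
  trans (composeCol-crossˡ {c = c} {d} x<p p<y y<p+m) (sym (composeCol-crossˡ {c = c} {d′} x<p p<y y<p+m))
... | crossʳ p<x x<p+m p+m<y =
  trans (composeCol-crossʳ {c = c} {d} p<x x<p+m p+m<y) (sym (composeCol-crossʳ {c = c} {d′} p<x x<p+m p+m<y))

composeCol-shift : ∀ {c₁ c₂ d : Colouring} {k a p m₀} → p < a →
  (∀ u v → u < v → v ≤ a → Arc≢ u v 0 a → c₁ u v ≡ c₂ (k + u) (k + v)) →
  ∀ x y → x < y → y ≤ a + m₀ → Arc≢ x y 0 (a + m₀) →
  composeCol c₁ p (suc m₀) d x y ≡ composeCol c₂ (k + p) (suc m₀) d (k + x) (k + y)
composeCol-shift {c₁} {c₂} {d} {k} {a} {p} {m₀} p<a c₁≗c₂ x y x<y y≤ ≢base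
  with composeArc p m₀ x y x<y
... | left _ y≤p =
  trans (composeCol-left {c = c₁} {d} x<y y≤p)
    (trans (c₁≗c₂ x y x<y (≤-trans y≤p (<⇒≤ p<a)) (λ _ e → <-irrefl e (≤-<-trans y≤p p<a)))
      (sym (composeCol-left {c = c₂} {d} (+-monoʳ-< k x<y) (+-monoʳ-≤ k y≤p))))
... | glued =
  trans (composeCol-glued {c = c₁} {d} {p})
    (trans (cong (λ z → merge z (d 0 (suc m₀)))
             (trans (c₁≗c₂ p (suc p) ≤-refl p<a (λ e₁ e₂ → ≢base e₁ (trans (+-suc p m₀) (cong (_+ m₀) e₂))))
                    (cong (c₂ (k + p)) (+-suc k p))))
      (sym (trans (cong (composeCol c₂ (k + p) (suc m₀) d (k + p)) (sym (+-assoc k p (suc m₀))))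
                  (composeCol-glued {c = c₂} {d} {k + p}))))
... | inner {u} {v} u<v v≤m ≢base′ =
  trans (composeCol-inner {c = c₁} {d} {p} u<v v≤m ≢base′)
    (sym (trans (cong₂ (composeCol c₂ (k + p) (suc m₀) d) (sym (+-assoc k p u)) (sym (+-assoc k p v)))
                (composeCol-inner {c = c₂} {d} {k + p} u<v v≤m ≢base′)))
... | over {x} {v} x≤p p<v ≢edge =
  trans (composeCol-over {c = c₁} {d} x≤p p<v ≢edge)
    (trans (c₁≗c₂ x v (≤-<-trans x≤p p<v) (+-cancelʳ-≤ m₀ v a y≤) (λ e₁ e₂ → ≢base e₁ (cong (_+ m₀) e₂)))
      (sym (trans (cong (composeCol c₂ (k + p) (suc m₀) d (k + x)) (sym (+-assoc k v m₀)))
             (composeCol-over {c = c₂} {d} {k + p} {m₀} {k + x} {k + v} (+-monoʳ-≤ k x≤p) (+-monoʳ-< k p<v)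
               (λ e₁ e₂ → ≢edge (+-cancelˡ-≡ k x p e₁) (+-cancelˡ-≡ k v (suc p) (trans e₂ (sym (+-suc k p)))))))))
... | right {u} {v} p<u u<v =
  trans (composeCol-right {c = c₁} {d} p<u u<v)
    (trans (c₁≗c₂ u v u<v (+-cancelʳ-≤ m₀ v a y≤) (λ e _ → <⇒≢ (≤-<-trans z≤n p<u) (sym e)))
      (sym (trans (cong₂ (composeCol c₂ (k + p) (suc m₀) d) (sym (+-assoc k u m₀)) (sym (+-assoc k v m₀)))
             (composeCol-right {c = c₂} {d} (+-monoʳ-< k p<u) (+-monoʳ-< k u<v)))))
... | crossˡ x<p p<y y<p+m =
  trans (composeCol-crossˡ {c = c₁} {d} x<p p<y y<p+m)
    (sym (composeCol-crossˡ {c = c₂} {d} (+-monoʳ-< k x<p) (+-monoʳ-< k p<y)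
           (subst (k + y <_) (sym (+-assoc k p (suc m₀))) (+-monoʳ-< k y<p+m))))
... | crossʳ p<x x<p+m p+m<y =
  trans (composeCol-crossʳ {c = c₁} {d} p<x x<p+m p+m<y)
    (sym (composeCol-crossʳ {c = c₂} {d} (+-monoʳ-< k p<x)
           (subst (k + x <_) (sym (+-assoc k p (suc m₀))) (+-monoʳ-< k x<p+m))
           (subst (_< k + y) (sym (+-assoc k p (suc m₀))) (+-monoʳ-< k p+m<y))))

composeCol-congˡ : ∀ {c c′ d : Colouring} {n p m₀} → p < n → Agree n c c′ →
                   Agree (n + m₀) (composeCol c p (suc m₀) d) (composeCol c′ p (suc m₀) d)
composeCol-congˡ {c} {c′} {d} {n} {p} {m₀} p<n c≗c′ =
  agree-split (base-arc n p<n c≗c′)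
    (composeCol-shift {d = d} {k = 0} p<n (λ u v u<v v≤ _ → c≗c′ u v u<v v≤))
  where
  base-arc : ∀ n → p < n → Agree n c c′ →
             composeCol c p (suc m₀) d 0 (n + m₀) ≡ composeCol c′ p (suc m₀) d 0 (n + m₀)
  base-arc 1 (s≤s z≤n) c≗c′ =
    trans (composeCol-glued {c = c} {d} {0})
      (trans (cong (λ z → merge z (d 0 (suc m₀))) (c≗c′ 0 1 (s≤s z≤n) ≤-refl))
        (sym (composeCol-glued {c = c′} {d} {0})))
  base-arc (suc (suc n₀)) p<n c≗c′ =
    trans (composeCol-over {c = c} {d} {p} {m₀} {0} {suc (suc n₀)} z≤n p<n ≢edge)
      (trans (c≗c′ 0 (suc (suc n₀)) (s≤s z≤n) ≤-refl)
        (sym (composeCol-over {c = c′} {d} {p} {m₀} {0} {suc (suc n₀)} z≤n p<n ≢edge)))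
    where
    ≢edge : Arc≢ 0 (suc (suc n₀)) p (suc p)
    ≢edge refl ()

≈-refl : ∀ {C} → C ≈ C
≈-refl = refl , λ _ _ _ _ → refl

≈-sym : ∀ {C D} → C ≈ D → D ≈ C
≈-sym (e , f) = sym e , λ x y x<y y≤ → sym (f x y x<y (subst (y ≤_) (sym e) y≤))

≈-trans : ∀ {C D E} → C ≈ D → D ≈ E → C ≈ E
≈-trans (e₁ , f₁) (e₂ , f₂) =
  trans e₁ e₂ , λ x y x<y y≤ → trans (f₁ x y x<y y≤) (f₂ x y x<y (subst (y ≤_) e₁ y≤))

≈-base : ∀ {C D} → C ≈ D → 1 ≤ size C → col C 0 (size C) ≡ col D 0 (size D)
≈-base {C} {D} (e , f) 1≤C = trans (f 0 (size C) 1≤C ≤-refl) (cong (col D 0) e)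

pred-< : ∀ {i n} → 1 ≤ i → i ≤ n → i ∸ 1 < n
pred-< {suc _} _ i≤n = i≤n

compose-cong : ∀ {C C′ D D′ i} → C ≈ C′ → D ≈ D′ → 1 ≤ i → i ≤ size C → 1 ≤ size D →
               compose C i D ≈ compose C′ i D′
compose-cong {D = mk zero _} _ _ _ _ ()
compose-cong {C} {C′} {mk (suc m₀) d} {mk _ d′} {i} (eC , C≗C′) (refl , d≗d′) 1≤i i≤C _ =
  cong (λ n → n + suc m₀ ∸ 1) eC , λ x y x<y y≤ →
    trans (composeCol-congˡ {d = d} (pred-< 1≤i i≤C) C≗C′ x y x<y
             (subst (y ≤_) (cong (_∸ 1) (+-suc (size C) m₀)) y≤))
          (composeCol-congʳ {col C′} {p = i ∸ 1} d≗d′ x y x<y)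

-- Colourings of nodes

edgeColour baseColour : Gen → Colour
edgeColour α = none
edgeColour β = blue
baseColour α = blue
baseColour β = none

πgen-edge₁ : ∀ g → col (πgen g) 0 1 ≡ edgeColour g
πgen-edge₁ α = refl
πgen-edge₁ β = refl

πgen-edge₂ : ∀ g → col (πgen g) 1 2 ≡ edgeColour g
πgen-edge₂ α = refl
πgen-edge₂ β = refl

πgen-base : ∀ g → col (πgen g) 0 2 ≡ baseColour g
πgen-base α = refl
πgen-base β = refl

nodeCol : Gen → Colouring → ℕ → Colouring → ℕ → Colouring
nodeCol g lc a rc b = composeCol (composeCol (col (πgen g)) 1 b rc) 0 a lc

module _ (g : Gen) (lc rc : Colouring) where

  private
    g∘₂R : ℕ → Colouring
    g∘₂R b = composeCol (col (πgen g)) 1 b rc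

  nodeCol-left : ∀ {a b x y} → x < y → y ≤ a → Arc≢ x y 0 a → nodeCol g lc a rc b x y ≡ lc x y
  nodeCol-left {a} {b} x<y y≤a ≢base = composeCol-inner {c = g∘₂R b} {lc} {0} x<y y≤a ≢base

  nodeCol-leftBase : ∀ {a b} → nodeCol g lc a rc b 0 a ≡ merge (edgeColour g) (lc 0 a)
  nodeCol-leftBase {a} {b} =
    trans (composeCol-glued {c = g∘₂R b} {lc} {0} {a})
      (cong (λ z → merge z (lc 0 a))
        (trans (composeCol-left {c = col (πgen g)} {rc} {1} {b} (s≤s z≤n) ≤-refl) (πgen-edge₁ g)))

  nodeCol-right : ∀ {a b u v} → 1 ≤ a → u < v → v ≤ b → Arc≢ u v 0 b →
                  nodeCol g lc a rc b (a + u) (a + v) ≡ rc u v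
  nodeCol-right {suc a₀} {b} {u} {v} (s≤s z≤n) u<v v≤b ≢base =
    trans (cong₂ (nodeCol g lc (suc a₀) rc b) (cong suc (+-comm a₀ u)) (cong suc (+-comm a₀ v)))
      (trans (composeCol-right {c = g∘₂R b} {lc} {0} {a₀} {suc u} {suc v} (s≤s z≤n) (s≤s u<v))
        (composeCol-inner {c = col (πgen g)} {rc} {1} {b} u<v v≤b ≢base))

  nodeCol-rightBase : ∀ {a b} → 1 ≤ a → 1 ≤ b → nodeCol g lc a rc b a (a + b) ≡ merge (edgeColour g) (rc 0 b)
  nodeCol-rightBase {suc a₀} {b} (s≤s z≤n) (s≤s z≤n) =
    trans (cong (nodeCol g lc (suc a₀) rc b (suc a₀)) (cong suc (+-comm a₀ b)))
      (trans (composeCol-right {c = g∘₂R b} {lc} {0} {a₀} {1} {suc b} (s≤s z≤n) (s≤s (s≤s z≤n)))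
        (trans (composeCol-glued {c = col (πgen g)} {rc} {1} {b}) (cong (λ z → merge z (rc 0 b)) (πgen-edge₂ g))))

  nodeCol-base : ∀ {a b} → 1 ≤ a → 1 ≤ b → nodeCol g lc a rc b 0 (a + b) ≡ baseColour g
  nodeCol-base {suc a₀} {suc b₀} (s≤s z≤n) (s≤s z≤n) =
    trans (cong (nodeCol g lc (suc a₀) rc (suc b₀) 0) (cong suc (+-comm a₀ (suc b₀))))
      (trans (composeCol-over {c = g∘₂R (suc b₀)} {lc} {0} {a₀} {0} {suc (suc b₀)} z≤n (s≤s z≤n) (λ _ ()))
        (trans (composeCol-over {c = col (πgen g)} {rc} {1} {b₀} {0} {2} z≤n (s≤s (s≤s z≤n)) (λ ()))
          (πgen-base g)))

  nodeCol-cross : ∀ {a b x y} → x < a → a < y → y ≤ a + b → Arc≢ x y 0 (a + b) → nodeCol g lc a rc b x y ≡ none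
  nodeCol-cross {zero} () _ _ _
  nodeCol-cross {suc a₀} {b} {zero} {y} _ a<y y≤a+b ≢base
    with offsetʳ {a₀} {y} (≤-trans (n≤1+n a₀) (<⇒≤ a<y))
  ... | v , refl =
    trans (composeCol-over {c = g∘₂R b} {lc} {0} {a₀} {0} {v} z≤n (<-trans (s≤s z≤n) 1<v)
            (λ _ e → <-irrefl (sym (cong (_+ a₀) e)) a<y))
      (composeCol-crossˡ {c = col (πgen g)} {rc} {1} {b} {0} {v} (s≤s z≤n) 1<v v<1+b)
    where
    1<v : 1 < v
    1<v = +-cancelʳ-≤ a₀ 2 v a<y
    v<1+b : v < 1 + b
    v<1+b = +-cancelʳ-< a₀ v (suc b) (subst (v + a₀ <_) (cong suc (+-comm a₀ b)) (≤∧≢⇒< y≤a+b (≢base refl)))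
  nodeCol-cross {suc a₀} {b} {suc x} {y} x<a a<y _ _ =
    composeCol-crossʳ {c = g∘₂R b} {lc} {0} {suc a₀} (s≤s z≤n) x<a a<y

data NodeArc (a b : ℕ) : ℕ → ℕ → Set where
  left      : ∀ {x y} → x < y → y ≤ a → Arc≢ x y 0 a → NodeArc a b x y
  leftBase  : NodeArc a b 0 a
  right     : ∀ {u v} → u < v → v ≤ b → Arc≢ u v 0 b → NodeArc a b (a + u) (a + v)
  rightBase : NodeArc a b a (a + b)
  base      : NodeArc a b 0 (a + b)
  cross     : ∀ {x y} → x < a → a < y → y ≤ a + b → Arc≢ x y 0 (a + b) → NodeArc a b x y

nodeArc : ∀ a b x y → x < y → y ≤ a + b → NodeArc a b x y
nodeArc a b x y x<y y≤a+b with y ≤? a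
... | yes y≤a with base-or-other x y a
...   | inj₁ (refl , refl) = leftBase
...   | inj₂ ≢base = left x<y y≤a ≢base
nodeArc a b x y x<y y≤a+b | no y≰a with x <? a
...   | yes x<a with base-or-other x y (a + b)
...     | inj₁ (refl , refl) = base
...     | inj₂ ≢base = cross x<a (≰⇒> y≰a) y≤a+b ≢base
nodeArc a b x y x<y y≤a+b | no y≰a | no x≮a with offsetˡ {a} {x} (≮⇒≥ x≮a) | offsetˡ {a} {y} (<⇒≤ (≰⇒> y≰a))
... | u , refl | v , refl with base-or-other u v b
...   | inj₁ (refl , refl) = subst (λ z → NodeArc a b z (a + b)) (sym (+-identityʳ a)) rightBase
...   | inj₂ ≢base = right (+-cancelˡ-< a u v x<y) (+-cancelˡ-≤ a v b y≤a+b) ≢base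

BaseColour : Colour → Set
BaseColour c = c ≡ blue ⊎ c ≡ none

merge-blueˡ : ∀ {c} → BaseColour c → merge blue c ≡ c
merge-blueˡ (inj₁ refl) = refl
merge-blueˡ (inj₂ refl) = refl

merge-unit-assoc : ∀ g {u t} → u ≡ blue → BaseColour t →
                   merge (edgeColour g) (merge u t) ≡ merge (merge (edgeColour g) u) t
merge-unit-assoc α refl (inj₁ refl) = refl
merge-unit-assoc α refl (inj₂ refl) = refl
merge-unit-assoc β refl (inj₁ refl) = refl
merge-unit-assoc β refl (inj₂ refl) = refl

graftˡ-leftBase : ∀ g {lc rc tc : Colouring} {b m₀} a {p} → p < a → (a ≡ 1 → lc 0 1 ≡ blue) →
  BaseColour (tc 0 (suc m₀)) →
  merge (edgeColour g) (composeCol lc p (suc m₀) tc 0 (a + m₀)) ≡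
  composeCol (nodeCol g lc a rc b) p (suc m₀) tc 0 (a + m₀)
graftˡ-leftBase g {lc} {rc} {tc} {b} {m₀} 1 (s≤s z≤n) unit-blue tc-base = begin
  merge (edgeColour g) (composeCol lc 0 (suc m₀) tc 0 (suc m₀))
    ≡⟨ cong (merge (edgeColour g)) (composeCol-glued {c = lc} {tc} {0}) ⟩
  merge (edgeColour g) (merge (lc 0 1) (tc 0 (suc m₀)))
    ≡⟨ merge-unit-assoc g (unit-blue refl) tc-base ⟩
  merge (merge (edgeColour g) (lc 0 1)) (tc 0 (suc m₀))
    ≡⟨ cong (λ z → merge z (tc 0 (suc m₀))) (sym (nodeCol-leftBase g lc rc {1} {b})) ⟩
  merge (nodeCol g lc 1 rc b 0 1) (tc 0 (suc m₀))
    ≡⟨ sym (composeCol-glued {c = nodeCol g lc 1 rc b} {tc} {0}) ⟩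
  composeCol (nodeCol g lc 1 rc b) 0 (suc m₀) tc 0 (suc m₀) ∎
  where open ≡-Reasoning
graftˡ-leftBase g {lc} {rc} {tc} {b} {m₀} (suc (suc a₀)) {p} p<a _ _ =
  trans (cong (merge (edgeColour g)) (composeCol-over {c = lc} {tc} {p} {m₀} z≤n p<a ≢edge))
    (sym (trans (composeCol-over {c = nodeCol g lc (suc (suc a₀)) rc b} {tc} {p} {m₀} z≤n p<a ≢edge)
      (nodeCol-leftBase g lc rc {suc (suc a₀)} {b})))
  where
  ≢edge : Arc≢ 0 (suc (suc a₀)) p (suc p)
  ≢edge refl ()

module _ (g : Gen) {lc rc tc : Colouring} {a b m₀ p : ℕ} (1≤a : 1 ≤ a) (1≤b : 1 ≤ b) (p<a : p < a) where

  private
    N L∘T : Colouring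
    N = nodeCol g lc a rc b
    L∘T = composeCol lc p (suc m₀) tc
    1≤a′ : 1 ≤ a + m₀
    1≤a′ = ≤-trans 1≤a (m≤m+n a m₀)
    p+m≤a′ : p + suc m₀ ≤ a + m₀
    p+m≤a′ = shifted-≤ p<a

  graftˡ-cross : ∀ {x y} → x < a + m₀ → a + m₀ < y → y ≤ a + m₀ + b → Arc≢ x y 0 (a + m₀ + b) →
                 composeCol N p (suc m₀) tc x y ≡ none
  graftˡ-cross {x} {y} x<a′ a′<y y≤ ≢base with composeArc p m₀ x y (<-trans x<a′ a′<y)
  ... | left _ y≤p =
    ⊥-elim (<-irrefl refl (≤-<-trans (≤-trans y≤p (≤-trans (<⇒≤ p<a) (m≤m+n a m₀))) a′<y))
  ... | glued = ⊥-elim (<-irrefl refl (≤-<-trans p+m≤a′ a′<y))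
  ... | inner _ v≤m _ = ⊥-elim (<-irrefl refl (≤-<-trans (≤-trans (+-monoʳ-≤ p v≤m) p+m≤a′) a′<y))
  ... | crossˡ _ _ y<p+m = ⊥-elim (<-irrefl refl (<-trans (<-≤-trans y<p+m p+m≤a′) a′<y))
  ... | crossʳ p<x x<p+m p+m<y = composeCol-crossʳ {c = N} {tc} p<x x<p+m p+m<y
  ... | over {x} {v} x≤p p<v ≢edge =
    trans (composeCol-over {c = N} {tc} x≤p p<v ≢edge)
      (nodeCol-cross g lc rc (≤-<-trans x≤p p<a) (+-cancelʳ-< m₀ a v a′<y)
        (+-cancelʳ-≤ m₀ v (a + b) (subst (v + m₀ ≤_) (xy∙z≈xz∙y a m₀ b) y≤))
        (λ e₁ e₂ → ≢base e₁ (trans (cong (_+ m₀) e₂) (sym (xy∙z≈xz∙y a m₀ b)))))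
  ... | right {u} {v} p<u u<v =
    trans (composeCol-right {c = N} {tc} p<u u<v)
      (nodeCol-cross g lc rc (+-cancelʳ-< m₀ u a x<a′) (+-cancelʳ-< m₀ a v a′<y)
        (+-cancelʳ-≤ m₀ v (a + b) (subst (v + m₀ ≤_) (xy∙z≈xz∙y a m₀ b) y≤))
        (λ e _ → <-irrefl (sym e) (≤-<-trans z≤n p<u)))

  nodeCol-graftˡ : (a ≡ 1 → lc 0 1 ≡ blue) → BaseColour (tc 0 (suc m₀)) →
                   Agree (a + m₀ + b) (nodeCol g (composeCol lc p (suc m₀) tc) (a + m₀) rc b)
                                      (composeCol N p (suc m₀) tc)
  nodeCol-graftˡ unit-blue tc-base x y x<y y≤ with nodeArc (a + m₀) b x y x<y y≤
  ... | left _ y≤a′ ≢base =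
    trans (nodeCol-left g L∘T rc x<y y≤a′ ≢base)
      (composeCol-shift {d = tc} {k = 0} p<a
        (λ u v u<v v≤a ≢base′ → sym (nodeCol-left g lc rc u<v v≤a ≢base′)) x y x<y y≤a′ ≢base)
  ... | leftBase =
    trans (nodeCol-leftBase g L∘T rc) (graftˡ-leftBase g {lc} {rc} {tc} {b} a p<a unit-blue tc-base)
  ... | right {u} {v} u<v v≤b ≢base =
    trans (nodeCol-right g L∘T rc 1≤a′ u<v v≤b ≢base)
      (sym (trans (cong₂ (composeCol N p (suc m₀) tc) (xy∙z≈xz∙y a m₀ u) (xy∙z≈xz∙y a m₀ v))
        (trans (composeCol-right {c = N} {tc} (≤-trans p<a (m≤m+n a u)) (+-monoʳ-< a u<v))
          (nodeCol-right g lc rc 1≤a u<v v≤b ≢base))))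
  ... | rightBase =
    trans (nodeCol-rightBase g L∘T rc 1≤a′ 1≤b)
      (sym (trans (cong (composeCol N p (suc m₀) tc (a + m₀)) (xy∙z≈xz∙y a m₀ b))
        (trans (composeCol-right {c = N} {tc} p<a (m<m+n a 1≤b))
          (nodeCol-rightBase g lc rc 1≤a 1≤b))))
  ... | base =
    trans (nodeCol-base g L∘T rc 1≤a′ 1≤b)
      (sym (trans (cong (composeCol N p (suc m₀) tc 0) (xy∙z≈xz∙y a m₀ b))
        (trans (composeCol-over {c = N} {tc} z≤n (≤-trans p<a (m≤m+n a b))
                  (λ _ e → <-irrefl (sym e) (≤-trans (s≤s p<a) (m<m+n a 1≤b))))
          (nodeCol-base g lc rc 1≤a 1≤b))))
  ... | cross x<a′ a′<y y≤′ ≢base =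
    trans (nodeCol-cross g L∘T rc x<a′ a′<y y≤′ ≢base)
      (sym (graftˡ-cross x<a′ a′<y y≤′ ≢base))

graftʳ-rightBase : ∀ g {lc rc tc : Colouring} {a m₀} b {q} → 1 ≤ a → q < b → (b ≡ 1 → rc 0 1 ≡ blue) →
  BaseColour (tc 0 (suc m₀)) →
  merge (edgeColour g) (composeCol rc q (suc m₀) tc 0 (b + m₀)) ≡
  composeCol (nodeCol g lc a rc b) (a + q) (suc m₀) tc a (a + (b + m₀))
graftʳ-rightBase g {lc} {rc} {tc} {a} {m₀} 1 {0} 1≤a (s≤s z≤n) unit-blue tc-base = begin
  merge (edgeColour g) (composeCol rc 0 (suc m₀) tc 0 (suc m₀))
    ≡⟨ cong (merge (edgeColour g)) (composeCol-glued {c = rc} {tc} {0}) ⟩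
  merge (edgeColour g) (merge (rc 0 1) (tc 0 (suc m₀)))
    ≡⟨ merge-unit-assoc g (unit-blue refl) tc-base ⟩
  merge (merge (edgeColour g) (rc 0 1)) (tc 0 (suc m₀))
    ≡⟨ cong (λ z → merge z (tc 0 (suc m₀))) (sym (nodeCol-rightBase g lc rc {a} {1} 1≤a (s≤s z≤n))) ⟩
  merge (N a (a + 1)) (tc 0 (suc m₀))
    ≡⟨ cong (λ z → merge (N a z) (tc 0 (suc m₀))) (+-comm a 1) ⟩
  merge (N a (suc a)) (tc 0 (suc m₀))
    ≡⟨ sym (composeCol-glued {c = N} {tc} {a}) ⟩
  composeCol N a (suc m₀) tc a (a + suc m₀)
    ≡⟨ cong (λ p → composeCol N p (suc m₀) tc a (a + suc m₀)) (sym (+-identityʳ a)) ⟩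
  composeCol N (a + 0) (suc m₀) tc a (a + suc m₀) ∎
  where
  open ≡-Reasoning
  N : Colouring
  N = nodeCol g lc a rc 1
graftʳ-rightBase g {lc} {rc} {tc} {a} {m₀} (suc (suc b₀)) {q} 1≤a q<b _ _ =
  trans (cong (merge (edgeColour g)) (composeCol-over {c = rc} {tc} {q} {m₀} z≤n q<b ≢edge))
    (sym (trans (cong (composeCol N (a + q) (suc m₀) tc a) (sym (+-assoc a (suc (suc b₀)) m₀)))
      (trans (composeCol-over {c = N} {tc} {a + q} {m₀} {a} {a + suc (suc b₀)} (m≤m+n a q) (+-monoʳ-< a q<b)
                (λ e₁ e₂ → ≢edge (+-cancelˡ-≡ a 0 q (trans (+-identityʳ a) e₁))
                                 (+-cancelˡ-≡ a (suc (suc b₀)) (suc q) (trans e₂ (sym (+-suc a q))))))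
        (nodeCol-rightBase g lc rc {a} {suc (suc b₀)} 1≤a (s≤s z≤n)))))
  where
  N : Colouring
  N = nodeCol g lc a rc (suc (suc b₀))
  ≢edge : Arc≢ 0 (suc (suc b₀)) q (suc q)
  ≢edge refl ()

module _ (g : Gen) {lc rc tc : Colouring} {a b m₀ q : ℕ} (1≤a : 1 ≤ a) (1≤b : 1 ≤ b) (q<b : q < b) where

  private
    N R∘T : Colouring
    N = nodeCol g lc a rc b
    R∘T = composeCol rc q (suc m₀) tc
    1≤b′ : 1 ≤ b + m₀
    1≤b′ = ≤-trans 1≤b (m≤m+n b m₀)
    a+q<a+b : a + q < a + b
    a+q<a+b = +-monoʳ-< a q<b

  graftʳ-cross : ∀ {x y} → x < a → a < y → y ≤ a + (b + m₀) → Arc≢ x y 0 (a + (b + m₀)) →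
                 composeCol N (a + q) (suc m₀) tc x y ≡ none
  graftʳ-cross {x} {y} x<a a<y y≤ ≢base with composeArc (a + q) m₀ x y (<-trans x<a a<y)
  ... | left _ y≤p =
    trans (composeCol-left {c = N} {tc} (<-trans x<a a<y) y≤p)
      (nodeCol-cross g lc rc x<a a<y (≤-trans y≤p (<⇒≤ a+q<a+b))
        (λ _ e → <-irrefl e (≤-<-trans y≤p a+q<a+b)))
  ... | glued = ⊥-elim (<-irrefl refl (<-≤-trans x<a (m≤m+n a q)))
  ... | inner {u} _ _ _ = ⊥-elim (<-irrefl refl (<-≤-trans x<a (≤-trans (m≤m+n a q) (m≤m+n (a + q) u))))
  ... | crossˡ x<p p<y y<p+m = composeCol-crossˡ {c = N} {tc} x<p p<y y<p+m
  ... | crossʳ p<x _ _ = ⊥-elim (<-irrefl refl (<-trans x<a (≤-<-trans (m≤m+n a q) p<x)))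
  ... | right {u} p<u _ =
    ⊥-elim (<-irrefl refl (<-≤-trans x<a (≤-trans (≤-trans (m≤m+n a q) (<⇒≤ p<u)) (m≤m+n u m₀))))
  ... | over {x} {v} x≤p p<v ≢edge =
    trans (composeCol-over {c = N} {tc} x≤p p<v ≢edge)
      (nodeCol-cross g lc rc x<a (≤-<-trans (m≤m+n a q) p<v) v≤a+b
        (λ e₁ e₂ → ≢base e₁ (trans (cong (_+ m₀) e₂) (+-assoc a b m₀))))
    where
    v≤a+b : v ≤ a + b
    v≤a+b = +-cancelʳ-≤ m₀ v (a + b) (subst (v + m₀ ≤_) (sym (+-assoc a b m₀)) y≤)

  nodeCol-graftʳ : (b ≡ 1 → rc 0 1 ≡ blue) → BaseColour (tc 0 (suc m₀)) →
                   Agree (a + (b + m₀)) (nodeCol g lc a R∘T (b + m₀)) (composeCol N (a + q) (suc m₀) tc)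
  nodeCol-graftʳ unit-blue tc-base x y x<y y≤ with nodeArc a (b + m₀) x y x<y y≤
  ... | left _ y≤a ≢base =
    trans (nodeCol-left g lc R∘T x<y y≤a ≢base)
      (sym (trans (composeCol-left {c = N} {tc} x<y (≤-trans y≤a (m≤m+n a q)))
        (nodeCol-left g lc rc x<y y≤a ≢base)))
  ... | leftBase =
    trans (nodeCol-leftBase g lc R∘T {a})
      (sym (trans (composeCol-left {c = N} {tc} 1≤a (m≤m+n a q)) (nodeCol-leftBase g lc rc {a} {b})))
  ... | right {u} {v} u<v v≤ ≢base =
    trans (nodeCol-right g lc R∘T 1≤a u<v v≤ ≢base)
      (composeCol-shift {c₁ = rc} {c₂ = N} {d = tc} {k = a} q<b
        (λ u v u<v v≤b ≢base′ → sym (nodeCol-right g lc rc {a} {b} 1≤a u<v v≤b ≢base′)) u v u<v v≤ ≢base)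
  ... | rightBase =
    trans (nodeCol-rightBase g lc R∘T 1≤a 1≤b′)
      (graftʳ-rightBase g {lc} {rc} {tc} b 1≤a q<b unit-blue tc-base)
  ... | base =
    trans (nodeCol-base g lc R∘T 1≤a 1≤b′)
      (sym (trans (cong (composeCol N (a + q) (suc m₀) tc 0) (sym (+-assoc a b m₀)))
        (trans (composeCol-over {c = N} {tc} z≤n a+q<a+b (λ e _ → <-irrefl e (≤-trans 1≤a (m≤m+n a q))))
          (nodeCol-base g lc rc 1≤a 1≤b))))
  ... | cross x<a a<y y≤′ ≢base =
    trans (nodeCol-cross g lc R∘T x<a a<y y≤′ ≢base)
      (sym (graftʳ-cross x<a a<y y≤′ ≢base))

-- π is an operad morphism

record WellFormed (C : BNC) : Set where
  field
    size-pos    : 1 ≤ size C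
    unit-blue   : size C ≡ 1 → col C 0 1 ≡ blue
    base-colour : BaseColour (col C 0 (size C))
open WellFormed

compose-unitˡ : ∀ {D} → BaseColour (col D 0 (size D)) → compose unitB 1 D ≈ D
compose-unitˡ {mk m d} d-base =
  refl , agree-split (trans (composeCol-glued {λ _ _ → blue} {d} {0} {m}) (merge-blueˡ d-base))
                     (λ x y x<y y≤m ≢base → composeCol-inner {λ _ _ → blue} {d} {0} x<y y≤m ≢base)

nodeB : Gen → BNC → BNC → BNC
nodeB g L R = compose (compose (πgen g) 2 R) 1 L

πgen-size : ∀ g → size (πgen g) ≡ 2
πgen-size α = refl
πgen-size β = refl

nodeB-size : ∀ g L R → size (nodeB g L R) ≡ size R + size L
nodeB-size g L R = cong (λ n → n + size R ∸ 1 + size L ∸ 1) (πgen-size g)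

gen∘₂-size-pos : ∀ g R → 1 ≤ size (compose (πgen g) 2 R)
gen∘₂-size-pos g R = subst (1 ≤_) (sym (cong (λ n → n + size R ∸ 1) (πgen-size g))) (s≤s z≤n)

nodeB-cong : ∀ g {L L′ R R′} → 1 ≤ size L → 1 ≤ size R → L ≈ L′ → R ≈ R′ → nodeB g L R ≈ nodeB g L′ R′
nodeB-cong g {R = R} 1≤L 1≤R L≈L′ R≈R′ =
  compose-cong (compose-cong (≈-refl {πgen g}) R≈R′ (s≤s z≤n) (≤-reflexive (sym (πgen-size g))) 1≤R)
    L≈L′ (s≤s z≤n) (gen∘₂-size-pos g R) 1≤L

+suc∸1 : ∀ n m → n + suc m ∸ 1 ≡ n + m
+suc∸1 n m = cong (_∸ 1) (+-suc n m)

nodeB-graftˡ : ∀ g {L R T} i → WellFormed L → WellFormed R → WellFormed T → 1 ≤ i → i ≤ size L →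
               nodeB g (compose L i T) R ≈ compose (nodeB g L R) i T
nodeB-graftˡ g {T = mk zero _} i _ _ wT _ _ = ⊥-elim (1+n≰n (size-pos wT))
nodeB-graftˡ g {mk a lc} {mk b rc} {mk (suc m₀) tc} i wL wR wT 1≤i i≤a = size-eq , agree
  where
  L∘T = compose (mk a lc) i (mk (suc m₀) tc)
  size-eq : size (nodeB g L∘T (mk b rc)) ≡
            size (compose (nodeB g (mk a lc) (mk b rc)) i (mk (suc m₀) tc))
  size-eq = begin
    size (nodeB g L∘T (mk b rc))   ≡⟨ nodeB-size g L∘T (mk b rc) ⟩
    b + (a + suc m₀ ∸ 1)           ≡⟨ cong (b +_) (+suc∸1 a m₀) ⟩
    b + (a + m₀)                   ≡⟨ sym (+-assoc b a m₀) ⟩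
    b + a + m₀                     ≡⟨ sym (+suc∸1 (b + a) m₀) ⟩
    b + a + suc m₀ ∸ 1             ≡⟨ cong (λ n → n + suc m₀ ∸ 1) (sym (nodeB-size g (mk a lc) (mk b rc))) ⟩
    size (nodeB g (mk a lc) (mk b rc)) + suc m₀ ∸ 1 ∎
    where open ≡-Reasoning
  agree : Agree (size (nodeB g L∘T (mk b rc))) (col (nodeB g L∘T (mk b rc)))
                (col (compose (nodeB g (mk a lc) (mk b rc)) i (mk (suc m₀) tc)))
  agree x y x<y y≤ =
    trans (cong (λ n → nodeCol g (col L∘T) n rc b x y) (+suc∸1 a m₀))
      (nodeCol-graftˡ g {lc} {rc} {tc} (size-pos wL) (size-pos wR) (pred-< 1≤i i≤a) (unit-blue wL)
        (base-colour wT) x y x<y y≤′)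
    where
    y≤′ : y ≤ a + m₀ + b
    y≤′ = subst (y ≤_) (trans (nodeB-size g L∘T (mk b rc)) (trans (+-comm b _) (cong (_+ b) (+suc∸1 a m₀)))) y≤

nodeB-graftʳ : ∀ g {L R T} j → WellFormed L → WellFormed R → WellFormed T → 1 ≤ j → j ≤ size R →
               nodeB g L (compose R j T) ≈ compose (nodeB g L R) (size L + j) T
nodeB-graftʳ g {T = mk zero _} j _ _ wT _ _ = ⊥-elim (1+n≰n (size-pos wT))
nodeB-graftʳ g {mk a lc} {mk b rc} {mk (suc m₀) tc} j wL wR wT 1≤j j≤b = size-eq , agree
  where
  R∘T = compose (mk b rc) j (mk (suc m₀) tc)
  size-eq : size (nodeB g (mk a lc) R∘T) ≡
            size (compose (nodeB g (mk a lc) (mk b rc)) (a + j) (mk (suc m₀) tc))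
  size-eq = begin
    size (nodeB g (mk a lc) R∘T)   ≡⟨ nodeB-size g (mk a lc) R∘T ⟩
    b + suc m₀ ∸ 1 + a             ≡⟨ cong (_+ a) (+suc∸1 b m₀) ⟩
    b + m₀ + a                     ≡⟨ xy∙z≈xz∙y b m₀ a ⟩
    b + a + m₀                     ≡⟨ sym (+suc∸1 (b + a) m₀) ⟩
    b + a + suc m₀ ∸ 1             ≡⟨ cong (λ n → n + suc m₀ ∸ 1) (sym (nodeB-size g (mk a lc) (mk b rc))) ⟩
    size (nodeB g (mk a lc) (mk b rc)) + suc m₀ ∸ 1 ∎
    where open ≡-Reasoning
  agree : Agree (size (nodeB g (mk a lc) R∘T)) (col (nodeB g (mk a lc) R∘T))
                (col (compose (nodeB g (mk a lc) (mk b rc)) (a + j) (mk (suc m₀) tc)))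
  agree x y x<y y≤ =
    trans (cong (λ n → nodeCol g lc a (col R∘T) n x y) (+suc∸1 b m₀))
      (trans (nodeCol-graftʳ g {lc} {rc} {tc} (size-pos wL) (size-pos wR) (pred-< 1≤j j≤b) (unit-blue wR)
                (base-colour wT) x y x<y y≤′)
        (cong (λ p → composeCol (nodeCol g lc a rc b) p (suc m₀) tc x y) (sym (+-∸-assoc a 1≤j))))
    where
    y≤′ : y ≤ a + (b + m₀)
    y≤′ = subst (y ≤_) (trans (nodeB-size g (mk a lc) R∘T) (trans (+-comm _ a) (cong (a +_) (+suc∸1 b m₀)))) y≤

arity-pos : ∀ t → 1 ≤ arity t
arity-pos leaf = s≤s z≤n
arity-pos (node _ l r) = ≤-trans (arity-pos l) (m≤m+n (arity l) (arity r))

π-size : ∀ t → size (π t) ≡ arity t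
π-size leaf = refl
π-size (node g l r) =
  trans (nodeB-size g (π l) (π r)) (trans (cong₂ _+_ (π-size r) (π-size l)) (+-comm (arity r) (arity l)))

π-size-pos : ∀ t → 1 ≤ size (π t)
π-size-pos t = subst (1 ≤_) (sym (π-size t)) (arity-pos t)

π-node-size : ∀ g l r → 2 ≤ size (π (node g l r))
π-node-size g l r = subst (2 ≤_) (sym (nodeB-size g (π l) (π r))) (+-mono-≤ (π-size-pos r) (π-size-pos l))

rootBase : Tree → Colour
rootBase leaf = blue
rootBase (node g _ _) = baseColour g

π-base : ∀ t → col (π t) 0 (size (π t)) ≡ rootBase t
π-base leaf = refl
π-base (node g l r) =
  trans (cong (col (π (node g l r)) 0) (trans (nodeB-size g (π l) (π r)) (+-comm (size (π r)) (size (π l)))))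
    (nodeCol-base g (col (π l)) (col (π r)) (π-size-pos l) (π-size-pos r))

π-wellFormed : ∀ t → WellFormed (π t)
π-wellFormed t = record { size-pos = π-size-pos t ; unit-blue = unit t ; base-colour = base-colour′ t }
  where
  unit : ∀ t → size (π t) ≡ 1 → col (π t) 0 1 ≡ blue
  unit leaf _ = refl
  unit (node g l r) e = ⊥-elim (<-irrefl (sym e) (π-node-size g l r))
  base-colour′ : ∀ t → BaseColour (col (π t) 0 (size (π t)))
  base-colour′ leaf = inj₁ refl
  base-colour′ (node α l r) = inj₁ (π-base (node α l r))
  base-colour′ (node β l r) = inj₂ (π-base (node β l r))

π-graft : ∀ s i t → 1 ≤ i → i ≤ arity s → π (graft s i t) ≈ compose (π s) i (π t)
π-graft leaf .1 t (s≤s z≤n) (s≤s z≤n) = ≈-sym (compose-unitˡ (base-colour (π-wellFormed t)))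
π-graft (node g l r) i t 1≤i i≤ with i ≤? arity l
... | yes i≤l rewrite ≤ᵇ-true i≤l =
  ≈-trans (nodeB-cong g (π-size-pos (graft l i t)) (π-size-pos r) (π-graft l i t 1≤i i≤l) (≈-refl {π r}))
    (nodeB-graftˡ g {π l} {π r} {π t} i (π-wellFormed l) (π-wellFormed r) (π-wellFormed t) 1≤i
      (subst (i ≤_) (sym (π-size l)) i≤l))
... | no i≰l rewrite ≤ᵇ-false (≰⇒> i≰l) =
  ≈-trans (nodeB-cong g (π-size-pos l) (π-size-pos (graft r j t)) (≈-refl {π l}) (π-graft r j t 1≤j j≤r))
    (subst (λ k → nodeB g (π l) (compose (π r) j (π t)) ≈ compose (π (node g l r)) k (π t)) l+j≡i
      (nodeB-graftʳ g {π l} {π r} {π t} j (π-wellFormed l) (π-wellFormed r) (π-wellFormed t) 1≤j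
        (subst (j ≤_) (sym (π-size r)) j≤r)))
  where
  j = i ∸ arity l
  1≤j : 1 ≤ j
  1≤j = m<n⇒0<n∸m (≰⇒> i≰l)
  j≤r : j ≤ arity r
  j≤r = m≤n+o⇒m∸n≤o i (arity l) i≤
  l+j≡i : size (π l) + j ≡ i
  l+j≡i = trans (cong (_+ j) (π-size l)) (m+[n∸m]≡n (<⇒≤ (≰⇒> i≰l)))

agree-square : ∀ {c c′ : Colouring} → c 0 1 ≡ c′ 0 1 → c 0 2 ≡ c′ 0 2 → c 0 3 ≡ c′ 0 3 →
               c 1 2 ≡ c′ 1 2 → c 1 3 ≡ c′ 1 3 → c 2 3 ≡ c′ 2 3 → Agree 3 c c′
agree-square e01 _ _ _ _ _ .0 .1 (s≤s z≤n) (s≤s z≤n) = e01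
agree-square _ e02 _ _ _ _ .0 .2 (s≤s z≤n) (s≤s (s≤s z≤n)) = e02
agree-square _ _ e03 _ _ _ .0 .3 (s≤s z≤n) (s≤s (s≤s (s≤s z≤n))) = e03
agree-square _ _ _ e12 _ _ .1 .2 (s≤s (s≤s z≤n)) (s≤s (s≤s z≤n)) = e12
agree-square _ _ _ _ e13 _ .1 .3 (s≤s (s≤s z≤n)) (s≤s (s≤s (s≤s z≤n))) = e13
agree-square _ _ _ _ _ e23 .2 .3 (s≤s (s≤s (s≤s z≤n))) (s≤s (s≤s (s≤s z≤n))) = e23

π-axiom : ∀ g → π (node g (node g leaf leaf) leaf) ≈ π (node g leaf (node g leaf leaf))
π-axiom α = refl , agree-square refl refl refl refl refl refl
π-axiom β = refl , agree-square refl refl refl refl refl refl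

π-sound : ∀ {s t} → s ≅ t → π s ≈ π t
π-sound ax-β = π-axiom β
π-sound ax-α = π-axiom α
π-sound ≅-refl = ≈-refl
π-sound (≅-sym s≅t) = ≈-sym (π-sound s≅t)
π-sound (≅-trans s≅t t≅u) = ≈-trans (π-sound s≅t) (π-sound t≅u)
π-sound (≅-comp {s} {s′} {t} {t′} i 1≤i i≤s s≅s′ t≅t′) =
  ≈-trans (π-graft s i t 1≤i i≤s)
    (≈-trans (compose-cong πs≈πs′ (π-sound t≅t′) 1≤i (subst (i ≤_) (sym (π-size s)) i≤s) (π-size-pos t))
      (≈-sym (π-graft s′ i t′ 1≤i i≤s′)))
  where
  πs≈πs′ : π s ≈ π s′
  πs≈πs′ = π-sound s≅s′
  i≤s′ : i ≤ arity s′
  i≤s′ = subst (i ≤_) (trans (sym (π-size s)) (trans (proj₁ πs≈πs′) (π-size s′))) i≤s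

agree-triangle : ∀ {c c′ : Colouring} → c 0 1 ≡ c′ 0 1 → c 0 2 ≡ c′ 0 2 → c 1 2 ≡ c′ 1 2 → Agree 2 c c′
agree-triangle e01 _ _ .0 .1 (s≤s z≤n) (s≤s z≤n) = e01
agree-triangle _ e02 _ .0 .2 (s≤s z≤n) (s≤s (s≤s z≤n)) = e02
agree-triangle _ _ e12 .1 .2 (s≤s (s≤s z≤n)) (s≤s (s≤s z≤n)) = e12

πgen-generated : ∀ g → InGen (πgen g)
πgen-generated α = g-bab
πgen-generated β = g-aba

π-generated : ∀ t → InGen (π t)
π-generated leaf = g-unit
π-generated (node g l r) =
  g-comp 1 (s≤s z≤n) (gen∘₂-size-pos g (π r))
    (g-comp 2 (s≤s z≤n) (≤-reflexive (sym (πgen-size g))) (πgen-generated g) (π-generated r)) (π-generated l)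

generated-π : ∀ C → InGen C → ∃ λ t → π t ≈ C
generated-π .unitB g-unit = leaf , ≈-refl
generated-π .τbab g-bab = node α leaf leaf , (refl , agree-triangle refl refl refl)
generated-π .τaba g-aba = node β leaf leaf , (refl , agree-triangle refl refl refl)
generated-π .(compose C i D) (g-comp {C} {D} i 1≤i i≤C inC inD) with generated-π C inC | generated-π D inD
... | s , πs≈C | t , πt≈D =
  graft s i t ,
  ≈-trans (π-graft s i t 1≤i i≤s) (compose-cong πs≈C πt≈D 1≤i (subst (i ≤_) (sym (proj₁ πs≈C)) i≤C) (π-size-pos t))
  where
  i≤s : i ≤ arity s
  i≤s = subst (i ≤_) (trans (sym (proj₁ πs≈C)) (π-size s)) i≤C

-- Normal forms

_≟ᴳ_ : DecidableEquality Gen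
α ≟ᴳ α = yes refl
α ≟ᴳ β = no λ ()
β ≟ᴳ α = no λ ()
β ≟ᴳ β = yes refl

root : Tree → Maybe Gen
root leaf = nothing
root (node g _ _) = just g

data Normal : Tree → Set where
  normal-leaf : Normal leaf
  normal-node : ∀ {g l r} → root l ≢ just g → Normal l → Normal r → Normal (node g l r)

≅-node : ∀ {g l l′ r r′} → l ≅ l′ → r ≅ r′ → node g l r ≅ node g l′ r′
≅-node {g} {r = r} {r′} l≅l′ r≅r′ =
  ≅-comp {s = node g leaf r} {s' = node g leaf r′} 1 (s≤s z≤n) (s≤s z≤n)
    (≅-comp {s = node g leaf leaf} 2 (s≤s z≤n) (s≤s (s≤s z≤n)) ≅-refl r≅r′) l≅l′

≅-axiom : ∀ g → node g (node g leaf leaf) leaf ≅ node g leaf (node g leaf leaf)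
≅-axiom α = ax-α
≅-axiom β = ax-β

≅-assoc : ∀ g a b c → node g (node g a b) c ≅ node g a (node g b c)
≅-assoc g a b c =
  ≅-comp {s = node g (node g leaf b) c} {s' = node g leaf (node g b c)} {t = a} 1 (s≤s z≤n) (s≤s z≤n)
    (≅-comp {s = node g (node g leaf leaf) c} {s' = node g leaf (node g leaf c)} {t = b} 2 (s≤s z≤n) (s≤s (s≤s z≤n))
      (≅-comp {t = c} 3 (s≤s z≤n) ≤-refl (≅-axiom g) ≅-refl) ≅-refl) ≅-refl

nodeNF : Gen → Tree → Tree → Tree
nodeNF g leaf r = node g leaf r
nodeNF g (node h u v) r with h ≟ᴳ g
... | yes _ = nodeNF g u (nodeNF g v r)
... | no _ = node g (node h u v) r

nodeNF-normal : ∀ g {l r} → Normal l → Normal r → Normal (nodeNF g l r)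
nodeNF-normal g {leaf} _ nr = normal-node (λ ()) normal-leaf nr
nodeNF-normal g {node h u v} nl nr with h ≟ᴳ g | nl
... | yes refl | normal-node _ nu nv = nodeNF-normal g nu (nodeNF-normal g nv nr)
... | no h≢g | _ = normal-node (λ e → h≢g (just-injective e)) nl nr

nodeNF-≅ : ∀ g l r → node g l r ≅ nodeNF g l r
nodeNF-≅ g leaf r = ≅-refl
nodeNF-≅ g (node h u v) r with h ≟ᴳ g
... | yes refl =
  ≅-trans (≅-assoc g u v r) (≅-trans (≅-node ≅-refl (nodeNF-≅ g v r)) (nodeNF-≅ g u (nodeNF g v r)))
... | no _ = ≅-refl

nf : Tree → Tree
nf leaf = leaf
nf (node g l r) = nodeNF g (nf l) (nf r)

nf-normal : ∀ t → Normal (nf t)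
nf-normal leaf = normal-leaf
nf-normal (node g l r) = nodeNF-normal g (nf-normal l) (nf-normal r)

nf-≅ : ∀ t → t ≅ nf t
nf-≅ leaf = ≅-refl
nf-≅ (node g l r) = ≅-trans (≅-node (nf-≅ l) (nf-≅ r)) (nodeNF-≅ g (nf l) (nf r))

-- Injectivity on normal forms

baseColour-injective : ∀ {g h} → baseColour g ≡ baseColour h → g ≡ h
baseColour-injective {α} {α} _ = refl
baseColour-injective {β} {β} _ = refl

merge-edgeColour-injective : ∀ g {x y} → BaseColour x → BaseColour y →
                             merge (edgeColour g) x ≡ merge (edgeColour g) y → x ≡ y
merge-edgeColour-injective α (inj₁ refl) (inj₁ refl) _ = refl
merge-edgeColour-injective α (inj₂ refl) (inj₂ refl) _ = refl
merge-edgeColour-injective β (inj₁ refl) (inj₁ refl) _ = refl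
merge-edgeColour-injective β (inj₂ refl) (inj₂ refl) _ = refl
merge-edgeColour-injective α (inj₁ refl) (inj₂ refl) ()
merge-edgeColour-injective α (inj₂ refl) (inj₁ refl) ()
merge-edgeColour-injective β (inj₁ refl) (inj₂ refl) ()
merge-edgeColour-injective β (inj₂ refl) (inj₁ refl) ()

merge-edgeColour-baseColour : ∀ {g h} → h ≢ g → merge (edgeColour g) (baseColour h) ≢ none
merge-edgeColour-baseColour {α} {α} h≢g _ = h≢g refl
merge-edgeColour-baseColour {β} {β} h≢g _ = h≢g refl

nodeB-leftSize : ∀ g {L R L′ R′} → 1 ≤ size L → 1 ≤ size R′ → nodeB g L R ≈ nodeB g L′ R′ →
                 size L < size L′ → merge (edgeColour g) (col L′ 0 (size L′)) ≡ none
nodeB-leftSize g {mk a lc} {mk b rc} {mk a′ lc′} {mk b′ rc′} 1≤a 1≤b′ (e , f) a<a′ = begin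
  merge (edgeColour g) (lc′ 0 a′)  ≡⟨ sym (nodeCol-leftBase g lc′ rc′ {a′} {b′}) ⟩
  nodeCol g lc′ a′ rc′ b′ 0 a′     ≡⟨ sym (f 0 a′ (≤-trans 1≤a (<⇒≤ a<a′)) a′≤size) ⟩
  nodeCol g lc a rc b 0 a′         ≡⟨ nodeCol-cross g lc rc 1≤a a<a′ (<⇒≤ a′<a+b) (λ _ e → <-irrefl e a′<a+b) ⟩
  none                             ∎
  where
  open ≡-Reasoning
  size≡b+a : size (nodeB g (mk a lc) (mk b rc)) ≡ b + a
  size≡b+a = nodeB-size g (mk a lc) (mk b rc)
  a′<a+b : a′ < a + b
  a′<a+b = subst (a′ <_) (trans (sym (trans (sym size≡b+a) (trans e (nodeB-size g (mk a′ lc′) (mk b′ rc′)))))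
                                (+-comm b a))
                 (m<n+m a′ 1≤b′)
  a′≤size : a′ ≤ size (nodeB g (mk a lc) (mk b rc))
  a′≤size = subst (a′ ≤_) (sym (trans size≡b+a (+-comm b a))) (<⇒≤ a′<a+b)

nodeB-injective : ∀ g {L R L′ R′} → WellFormed L → WellFormed R → WellFormed L′ → WellFormed R′ →
                  size L ≡ size L′ → nodeB g L R ≈ nodeB g L′ R′ → L ≈ L′ × R ≈ R′
nodeB-injective g {mk a lc} {mk b rc} {mk .a lc′} {mk b′ rc′} wL wR wL′ wR′ refl (e , f)
  with +-cancelʳ-≡ a b b′
         (trans (sym (nodeB-size g (mk a lc) (mk b rc))) (trans e (nodeB-size g (mk a lc′) (mk b′ rc′))))
... | refl = (refl , agreeˡ) , (refl , agreeʳ)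
  where
  f′ : Agree (a + b) (nodeCol g lc a rc b) (nodeCol g lc′ a rc′ b)
  f′ x y x<y y≤ = f x y x<y (subst (y ≤_) (trans (+-comm a b) (sym (nodeB-size g (mk a lc) (mk b rc)))) y≤)
  agreeˡ : Agree a lc lc′
  agreeˡ = agree-split
    (merge-edgeColour-injective g (base-colour wL) (base-colour wL′)
      (trans (sym (nodeCol-leftBase g lc rc {a} {b}))
        (trans (f′ 0 a (size-pos wL) (m≤m+n a b)) (nodeCol-leftBase g lc′ rc′ {a} {b}))))
    (λ u v u<v v≤a ≢base → trans (sym (nodeCol-left g lc rc {a} {b} u<v v≤a ≢base))
      (trans (f′ u v u<v (≤-trans v≤a (m≤m+n a b))) (nodeCol-left g lc′ rc′ {a} {b} u<v v≤a ≢base)))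
  agreeʳ : Agree b rc rc′
  agreeʳ = agree-split
    (merge-edgeColour-injective g (base-colour wR) (base-colour wR′)
      (trans (sym (nodeCol-rightBase g lc rc (size-pos wL) (size-pos wR)))
        (trans (f′ a (a + b) (m<m+n a (size-pos wR)) ≤-refl)
          (nodeCol-rightBase g lc′ rc′ (size-pos wL) (size-pos wR)))))
    (λ u v u<v v≤b ≢base → trans (sym (nodeCol-right g lc rc (size-pos wL) u<v v≤b ≢base))
      (trans (f′ (a + u) (a + v) (+-monoʳ-< a u<v) (+-monoʳ-≤ a v≤b))
        (nodeCol-right g lc′ rc′ (size-pos wL) u<v v≤b ≢base)))

π-leftBase-coloured : ∀ g t → root t ≢ just g → 1 < size (π t) →
                      merge (edgeColour g) (col (π t) 0 (size (π t))) ≢ none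
π-leftBase-coloured g leaf _ (s≤s ())
π-leftBase-coloured g (node h u v) h≢g _ rewrite π-base (node h u v) =
  merge-edgeColour-baseColour (λ h≡g → h≢g (cong just h≡g))

π-injective : ∀ {s t} → Normal s → Normal t → π s ≈ π t → s ≡ t
π-injective normal-leaf normal-leaf _ = refl
π-injective normal-leaf (normal-node {g} {l} {r} _ _ _) (e , _) = ⊥-elim (<-irrefl e (π-node-size g l r))
π-injective (normal-node {g} {l} {r} _ _ _) normal-leaf (e , _) = ⊥-elim (<-irrefl (sym e) (π-node-size g l r))
π-injective (normal-node {g} {l} {r} l≢g nl nr) (normal-node {g′} {l′} {r′} l′≢g′ nl′ nr′) πs≈πt
  with baseColour-injective {g} {g′}
         (trans (sym (π-base (node g l r)))
           (trans (≈-base πs≈πt (≤-trans (s≤s z≤n) (π-node-size g l r))) (π-base (node g′ l′ r′))))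
... | refl with <-cmp (size (π l)) (size (π l′))
... | tri< a<a′ _ _ =
  ⊥-elim (π-leftBase-coloured g l′ l′≢g′ (≤-<-trans (π-size-pos l) a<a′)
    (nodeB-leftSize g {π l} {π r} {π l′} {π r′} (π-size-pos l) (π-size-pos r′) πs≈πt a<a′))
... | tri> _ _ a′<a =
  ⊥-elim (π-leftBase-coloured g l l≢g (≤-<-trans (π-size-pos l′) a′<a)
    (nodeB-leftSize g {π l′} {π r′} {π l} {π r} (π-size-pos l′) (π-size-pos r) (≈-sym πs≈πt) a′<a))
... | tri≈ _ a≡a′ _
  with nodeB-injective g (π-wellFormed l) (π-wellFormed r) (π-wellFormed l′) (π-wellFormed r′) a≡a′ πs≈πt
...   | πl≈πl′ , πr≈πr′ = cong₂ (node g) (π-injective nl nl′ πl≈πl′) (π-injective nr nr′ πr≈πr′)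

π-complete : ∀ {s t} → π s ≈ π t → s ≅ t
π-complete {s} {t} πs≈πt = ≅-trans (subst (s ≅_) nf-s≡nf-t (nf-≅ s)) (≅-sym (nf-≅ t))
  where
  nf-s≡nf-t : nf s ≡ nf t
  nf-s≡nf-t = π-injective (nf-normal s) (nf-normal t)
    (≈-trans (≈-sym (π-sound (nf-≅ s))) (≈-trans πs≈πt (π-sound (nf-≅ t))))

mainTheorem19 : ((s t : Tree) → (π s ≈ π t → s ≅ t) × (s ≅ t → π s ≈ π t))
                × ((t : Tree) → InGen (π t))
                × ((C : BNC) → InGen C → ∃ λ t → π t ≈ C)
mainTheorem19 = (λ s t → π-complete , π-sound) , π-generated , generated-π
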